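{- Let $c\in\omega^\omega$ take only odd values, let $n>0$, let $k<\omega$ and $t\in 2^{<n}$ be such that $(p_k)^\frown t^\frown(0)$ and $(p_k)^\frown t^\frown(1)$ are both vertices of $L^c_n$. Then these two vertices are at odd distance from each other in $L^c_n$.
   Context: Fix distinct symbols $p_0,p_1,\dots$; vertices are finite sequences $(p_k)^\frown t$ with $t$ a finite binary string. For $c\in\omega^\omega$ define finite paths $L^c_n$ with endpoints $e^n_0,e^n_1$ recursively: $L^c_0$ has the single vertex $(p_0)$, no edges, and $e^0_0=e^0_1=(p_0)$. Given $L^c_n$, $L^c_{n+1}$ has vertices $v^\frown(i)$ for $v\in V(L^c_n)$, $i<2$, and new vertices $(p_0),\dots,(p_{c(n)})$; its edges are $\{v^\frown(i),w^\frown(i)\}$ for each edge $\{v,w\}$ of $L^c_n$ and $i<2$, plus the edges of the path $(e^n_1{}^\frown(0),(p_0),(p_1),\dots,(p_{c(n)}),e^n_1{}^\frown(1))$; its endpoints are $e^{n+1}_i=e^n_0{}^\frown(i)$. Distance is graph distance in the path $L^c_n$. -}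

module Defs where

open import Data.Nat using (ℕ; zero; suc; _+_; _*_; _≤_; _<_)
open import Data.Bool using (Bool; true; false)
open import Data.List using (List; []; _∷ʳ_)
open import Data.Product using (_×_; _,_; ∃)
open import Data.Sum using (_⊎_)
open import Relation.Binary.PropositionalEquality using (_≡_)

Odd : ℕ → Set
Odd m = ∃ λ j → m ≡ suc (2 * j)

-- A vertex (p_k)⌢t is represented as the pair (k , t), t a binary string
-- (false = 0, true = 1).
Vertex : Set
Vertex = ℕ × List Bool

_⌢_ : Vertex → Bool → Vertex
(k , t) ⌢ i = (k , t ∷ʳ i)

p : ℕ → Vertex
p k = (k , [])

e₀ : ℕ → Vertex
e₀ zero = p 0
e₀ (suc n) = e₀ n ⌢ false

e₁ : ℕ → Vertex
e₁ zero = p 0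
e₁ (suc n) = e₀ n ⌢ true

data Vtx (c : ℕ → ℕ) : ℕ → Vertex → Set where
  base : Vtx c 0 (p 0)
  copy : ∀ {n v} → Vtx c n v → (i : Bool) → Vtx c (suc n) (v ⌢ i)
  new  : ∀ {n k} → k ≤ c n → Vtx c (suc n) (p k)

-- edge set of L^c_n (each edge listed in one orientation)
data Edge (c : ℕ → ℕ) : ℕ → Vertex → Vertex → Set where
  copy  : ∀ {n v w} → Edge c n v w → (i : Bool) → Edge c (suc n) (v ⌢ i) (w ⌢ i)
  left  : ∀ {n} → Edge c (suc n) (e₁ n ⌢ false) (p 0)
  mid   : ∀ {n j} → j < c n → Edge c (suc n) (p j) (p (suc j))
  right : ∀ {n} → Edge c (suc n) (p (c n)) (e₁ n ⌢ true)

Adj : (ℕ → ℕ) → ℕ → Vertex → Vertex → Set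
Adj c n v w = Edge c n v w ⊎ Edge c n w v

data Walk (c : ℕ → ℕ) (n : ℕ) : Vertex → Vertex → ℕ → Set where
  stay : ∀ {v} → Vtx c n v → Walk c n v v 0
  step : ∀ {v u w d} → Adj c n v u → Walk c n u w d → Walk c n v w (suc d)

Dist : (ℕ → ℕ) → ℕ → Vertex → Vertex → ℕ → Set
Dist c n v w d = Walk c n v w d × (∀ d′ → Walk c n v w d′ → d ≤ d′)

{-# OPTIONS --safe #-}
-- Lay L^c_n out along ℕ: e₀ n sits at 0, e₁ n at ℓ n, and every edge joins two
-- consecutive positions. A walk therefore cannot be shorter than the difference of the
-- positions of its ends. The copy v⌢0 keeps the position x of v while v⌢1 is mirrored
-- to ℓ (n+1) − x, and the walk v⌢0 → e₁ n⌢0 → bridge → e₁ n⌢1 → v⌢1 realises exactly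
-- that difference, 2 (ℓ n − x) + c n + 2, which is odd when c n is.
module Submission where

open import Defs
open import Data.Nat using (ℕ; zero; suc; _+_; _*_; _∸_; _≤_; _<_; z≤n; s≤s)
open import Data.Nat.Properties
open import Data.Nat.Tactic.RingSolver using (solve-∀)
open import Data.Bool using (Bool; true; false)
open import Data.List using (List; []; _∷_; [_]; reverse; length)
open import Data.List.Properties using (reverse-++; ∷ʳ-injectiveˡ)
open import Data.Product using (_×_; _,_; proj₁; proj₂; ∃)
open import Data.Product.Properties using (,-injectiveˡ; ,-injectiveʳ)
open import Data.Sum using (_⊎_; inj₁; inj₂; swap)
open import Relation.Binary.PropositionalEquality hiding ([_])

[l+[b+l]]∸x≡l+[b+r] : ∀ {x r l} b → x + r ≡ l → l + (b + l) ∸ x ≡ l + (b + r)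
[l+[b+l]]∸x≡l+[b+r] {x} {r} b refl = begin
  x + r + (b + (x + r)) ∸ x   ≡⟨ cong (_∸ x) (shuffle x r b) ⟩
  x + (x + r + (b + r)) ∸ x   ≡⟨ m+n∸m≡n x _ ⟩
  x + r + (b + r)             ∎
  where
  open ≡-Reasoning
  shuffle : ∀ x r b → x + r + (b + (x + r)) ≡ x + (x + r + (b + r))
  shuffle = solve-∀

∸-flips-suc : ∀ {a b l} → b ≡ suc a → b ≤ l → l ∸ a ≡ suc (l ∸ b)
∸-flips-suc refl b≤l = +-∸-assoc 1 b≤l

Consecutive : ℕ → ℕ → Set
Consecutive a b = b ≡ suc a ⊎ a ≡ suc b

consecutive⇒≤1+ : ∀ {a b} → Consecutive a b → b ≤ suc a
consecutive⇒≤1+         (inj₁ refl) = ≤-refl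
consecutive⇒≤1+ {b = b} (inj₂ refl) = m≤n⇒m≤1+n (n≤1+n b)

r+[2+m+r]-odd : ∀ r {m} → Odd m → Odd (r + (2 + m + r))
r+[2+m+r]-odd r (j , refl) = r + j + 1 , shape r j
  where
  shape : ∀ r j → r + (2 + suc (2 * j) + r) ≡ suc (2 * (r + j + 1))
  shape = solve-∀

module L (c : ℕ → ℕ) where

  ℓ : ℕ → ℕ
  ℓ zero    = 0
  ℓ (suc n) = ℓ n + (2 + c n + ℓ n)

  ℓ≤ℓ-suc : ∀ n → ℓ n ≤ ℓ (suc n)
  ℓ≤ℓ-suc n = m≤m+n (ℓ n) _

  -- The position of a vertex along L^c_n, read off its string from the last bit: the
  -- copy ⌢0 keeps the position, the copy ⌢1 is mirrored, and p k sits k + 1 steps after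
  -- e₁ n ⌢ 0. Non-vertices get junk positions.
  posRev : ℕ → ℕ → List Bool → ℕ
  posRev zero    k _           = 0
  posRev (suc n) k []          = ℓ n + suc k
  posRev (suc n) k (false ∷ r) = posRev n k r
  posRev (suc n) k (true ∷ r)  = ℓ (suc n) ∸ posRev n k r

  pos : ℕ → Vertex → ℕ
  pos n (k , t) = posRev n k (reverse t)

  pos-⌢false : ∀ n v → pos (suc n) (v ⌢ false) ≡ pos n v
  pos-⌢false n (k , t) = cong (posRev (suc n) k) (reverse-++ t [ false ])

  pos-⌢true : ∀ n v → pos (suc n) (v ⌢ true) ≡ ℓ (suc n) ∸ pos n v
  pos-⌢true n (k , t) = cong (posRev (suc n) k) (reverse-++ t [ true ])

  pos-e₀ : ∀ n → pos n (e₀ n) ≡ 0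
  pos-e₀ zero    = refl
  pos-e₀ (suc n) = trans (pos-⌢false n (e₀ n)) (pos-e₀ n)

  pos-e₁ : ∀ n → pos n (e₁ n) ≡ ℓ n
  pos-e₁ zero    = refl
  pos-e₁ (suc n) = begin
    pos (suc n) (e₀ n ⌢ true)   ≡⟨ pos-⌢true n (e₀ n) ⟩
    ℓ (suc n) ∸ pos n (e₀ n)    ≡⟨ cong (ℓ (suc n) ∸_) (pos-e₀ n) ⟩
    ℓ (suc n)                   ∎
    where open ≡-Reasoning

  e₀-vertex : ∀ n → Vtx c n (e₀ n)
  e₀-vertex zero    = base
  e₀-vertex (suc n) = copy (e₀-vertex n) false

  e₁-vertex : ∀ n → Vtx c n (e₁ n)
  e₁-vertex zero    = base
  e₁-vertex (suc n) = copy (e₀-vertex n) true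

  edge-vertices : ∀ {n v w} → Edge c n v w → Vtx c n v × Vtx c n w
  edge-vertices (copy e i)    = copy (proj₁ (edge-vertices e)) i , copy (proj₂ (edge-vertices e)) i
  edge-vertices {suc n} left  = copy (e₁-vertex n) false , new z≤n
  edge-vertices (mid j<c)     = new (<⇒≤ j<c) , new j<c
  edge-vertices {suc n} right = new ≤-refl , copy (e₁-vertex n) true

  walk-start : ∀ {n v w d} → Walk c n v w d → Vtx c n v
  walk-start (stay v)          = v
  walk-start (step (inj₁ e) _) = proj₁ (edge-vertices e)
  walk-start (step (inj₂ e) _) = proj₂ (edge-vertices e)

  infixr 5 _++ʷ_
  _++ʷ_ : ∀ {n u v w a b} → Walk c n u v a → Walk c n v w b → Walk c n u w (a + b)
  stay _   ++ʷ q = q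
  step e p ++ʷ q = step e (p ++ʷ q)

  adj-sym : ∀ {n v w} → Adj c n v w → Adj c n w v
  adj-sym (inj₁ e) = inj₂ e
  adj-sym (inj₂ e) = inj₁ e

  reverseʷ : ∀ {n v w d} → Walk c n v w d → Walk c n w v d
  reverseʷ (stay v) = stay v
  reverseʷ {d = suc d} (step a q) =
    subst (Walk c _ _ _) (+-comm d 1) (reverseʷ q ++ʷ step (adj-sym a) (stay (walk-start (step a q))))

  copyᵃ : ∀ {n v w} → Adj c n v w → (i : Bool) → Adj c (suc n) (v ⌢ i) (w ⌢ i)
  copyᵃ (inj₁ e) i = inj₁ (copy e i)
  copyᵃ (inj₂ e) i = inj₂ (copy e i)

  copyʷ : ∀ {n v w d} → Walk c n v w d → (i : Bool) → Walk c (suc n) (v ⌢ i) (w ⌢ i) d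
  copyʷ (stay v)   i = stay (copy v i)
  copyʷ (step a q) i = step (copyᵃ a i) (copyʷ q i)

  new-to-left : ∀ {n} k → k ≤ c n → Walk c (suc n) (p k) (e₁ n ⌢ false) (suc k)
  new-to-left {n} zero    _   = step (inj₂ left) (stay (copy (e₁-vertex n) false))
  new-to-left     (suc k) k<c = step (inj₂ (mid k<c)) (new-to-left k (<⇒≤ k<c))

  new-to-right : ∀ {n k} d → d + k ≡ c n → Walk c (suc n) (p k) (e₁ n ⌢ true) (suc d)
  new-to-right {n}     zero    refl = step (inj₁ right) (stay (copy (e₁-vertex n) true))
  new-to-right {n} {k} (suc d) 1+d+k≡c =
    step (inj₁ (mid (≤-trans (s≤s (m≤n+m k d)) (≤-reflexive 1+d+k≡c))))
         (new-to-right d (trans (+-suc d k) 1+d+k≡c))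

  bridge : ∀ n → Walk c (suc n) (e₁ n ⌢ false) (e₁ n ⌢ true) (2 + c n)
  bridge n = reverseʷ (new-to-left 0 z≤n) ++ʷ new-to-right (c n) (+-identityʳ (c n))

  spine : ∀ n → Walk c n (e₀ n) (e₁ n) (ℓ n)
  spine zero    = stay base
  spine (suc n) = copyʷ (spine n) false ++ʷ bridge n ++ʷ copyʷ (reverseʷ (spine n)) true

  record Splits (n : ℕ) (v : Vertex) : Set where
    field
      rest     : ℕ
      pos+rest : pos n v + rest ≡ ℓ n
      from-e₀  : Walk c n (e₀ n) v (pos n v)
      to-e₁    : Walk c n v (e₁ n) rest

  open Splits public

  pos-⌢true-splits : ∀ {n v} (S : Splits n v) → pos (suc n) (v ⌢ true) ≡ ℓ n + (2 + c n + rest S)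
  pos-⌢true-splits {n} {v} S = trans (pos-⌢true n v) ([l+[b+l]]∸x≡l+[b+r] (2 + c n) (pos+rest S))

  pos≤ℓ-splits : ∀ {n v} → Splits n v → pos n v ≤ ℓ n
  pos≤ℓ-splits S = ≤-trans (m≤m+n _ (rest S)) (≤-reflexive (pos+rest S))

  splits : ∀ {n v} → Vtx c n v → Splits n v
  splits base = record { rest = 0 ; pos+rest = refl ; from-e₀ = stay base ; to-e₁ = stay base }
  splits {suc n} (copy {v = v} h false) = record
    { rest     = rest S + B
    ; pos+rest = begin
        pos (suc n) (v ⌢ false) + (rest S + B) ≡⟨ cong (_+ (rest S + B)) (pos-⌢false n v) ⟩
        pos n v + (rest S + B)                 ≡⟨ +-assoc (pos n v) (rest S) B ⟨
        pos n v + rest S + B                   ≡⟨ cong (_+ B) (pos+rest S) ⟩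
        ℓ n + B                                ∎
    ; from-e₀  = subst (Walk c _ _ _) (sym (pos-⌢false n v)) (copyʷ (from-e₀ S) false)
    ; to-e₁    = copyʷ (to-e₁ S) false ++ʷ bridge n ++ʷ copyʷ (reverseʷ (spine n)) true
    }
    where
    open ≡-Reasoning
    S = splits h
    B = 2 + c n + ℓ n
  splits {suc n} (copy {v = v} h true) = record
    { rest     = pos n v
    ; pos+rest = trans (cong (_+ pos n v) (pos-⌢true n v))
                       (m∸n+n≡m (≤-trans (pos≤ℓ-splits S) (ℓ≤ℓ-suc n)))
    ; from-e₀  = subst (Walk c _ _ _) (sym (pos-⌢true-splits S))
                   (copyʷ (spine n) false ++ʷ bridge n ++ʷ copyʷ (reverseʷ (to-e₁ S)) true)
    ; to-e₁    = copyʷ (reverseʷ (from-e₀ S)) true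
    }
    where
    S = splits h
  splits {suc n} (new {k = k} k≤c) with m≤n⇒∃[o]m+o≡n k≤c
  ... | d , k+d≡c = record
    { rest     = suc d + ℓ n
    ; pos+rest = subst (λ m → ℓ n + suc k + (suc d + ℓ n) ≡ ℓ n + (2 + m + ℓ n)) k+d≡c
                   (shape (ℓ n) k d)
    ; from-e₀  = copyʷ (spine n) false ++ʷ reverseʷ (new-to-left k k≤c)
    ; to-e₁    = new-to-right d (trans (+-comm d k) k+d≡c) ++ʷ copyʷ (reverseʷ (spine n)) true
    }
    where
    shape : ∀ l k d → l + suc k + (suc d + l) ≡ l + (2 + (k + d) + l)
    shape = solve-∀

  pos≤ℓ-suc : ∀ {n v} → Vtx c n v → pos n v ≤ ℓ (suc n)
  pos≤ℓ-suc {n} h = ≤-trans (pos≤ℓ-splits (splits h)) (ℓ≤ℓ-suc n)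

  edge-pos : ∀ {n v w} → Edge c n v w → Consecutive (pos n v) (pos n w)
  edge-pos {suc n} (copy {v = v} {w} e false) rewrite pos-⌢false n v | pos-⌢false n w = edge-pos e
  edge-pos {suc n} (copy {v = v} {w} e true) rewrite pos-⌢true n v | pos-⌢true n w with edge-pos e
  ... | inj₁ w≡1+v = inj₂ (∸-flips-suc w≡1+v (pos≤ℓ-suc (proj₂ (edge-vertices e))))
  ... | inj₂ v≡1+w = inj₁ (∸-flips-suc v≡1+w (pos≤ℓ-suc (proj₁ (edge-vertices e))))
  edge-pos {suc n} left rewrite pos-⌢false n (e₁ n) | pos-e₁ n = inj₁ (+-comm (ℓ n) 1)
  edge-pos {suc n} (mid {j = j} _) = inj₁ (+-suc (ℓ n) (suc j))
  edge-pos {suc n} right rewrite pos-⌢true n (e₁ n) | pos-e₁ n =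
    inj₁ (trans (m+n∸m≡n (ℓ n) _) (cong suc (+-comm (suc (c n)) (ℓ n))))

  adj-pos : ∀ {n v w} → Adj c n v w → pos n w ≤ suc (pos n v)
  adj-pos (inj₁ e) = consecutive⇒≤1+ (edge-pos e)
  adj-pos (inj₂ e) = consecutive⇒≤1+ (swap (edge-pos e))

  walk-pos : ∀ {n v w d} → Walk c n v w d → pos n w ≤ pos n v + d
  walk-pos (stay _) = m≤m+n _ 0
  walk-pos {n} {v} {w} (step {u = u} {d = d} a q) = begin
    pos n w              ≤⟨ walk-pos q ⟩
    pos n u + d          ≤⟨ +-monoˡ-≤ d (adj-pos a) ⟩
    suc (pos n v) + d    ≡⟨ +-suc (pos n v) d ⟨
    pos n v + suc d      ∎
    where open ≤-Reasoning

  copies-distance : ∀ {n v} (S : Splits n v) →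
    Dist c (suc n) (v ⌢ false) (v ⌢ true) (rest S + (2 + c n + rest S))
  copies-distance {n} {v} S = walk , shortest
    where
    B = 2 + c n + rest S
    D = rest S + B

    walk : Walk c (suc n) (v ⌢ false) (v ⌢ true) D
    walk = copyʷ (to-e₁ S) false ++ʷ bridge n ++ʷ copyʷ (reverseʷ (to-e₁ S)) true

    shortest : ∀ d → Walk c (suc n) (v ⌢ false) (v ⌢ true) d → D ≤ d
    shortest d w = +-cancelˡ-≤ (pos n v) D d (begin
      pos n v + D                 ≡⟨ +-assoc (pos n v) (rest S) B ⟨
      pos n v + rest S + B        ≡⟨ cong (_+ B) (pos+rest S) ⟩
      ℓ n + B                     ≡⟨ pos-⌢true-splits S ⟨
      pos (suc n) (v ⌢ true)      ≤⟨ walk-pos w ⟩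
      pos (suc n) (v ⌢ false) + d ≡⟨ cong (_+ d) (pos-⌢false n v) ⟩
      pos n v + d                 ∎)
      where open ≤-Reasoning

  ⌢-vertex⁻¹ : ∀ {n k t i} → Vtx c (suc n) ((k , t) ⌢ i) → Vtx c n (k , t)
  ⌢-vertex⁻¹ h = prefix h refl
    where
    prefix : ∀ {n w k t i} → Vtx c (suc n) w → w ≡ (k , t) ⌢ i → Vtx c n (k , t)
    prefix (copy {v = k′ , t′} h _) eq
      with refl ← ,-injectiveˡ eq | refl ← ∷ʳ-injectiveˡ t′ _ (,-injectiveʳ eq) = h
    prefix {t = []}    (new _) ()
    prefix {t = _ ∷ _} (new _) ()

lemma3p4 : (c : ℕ → ℕ) → (∀ m → Odd (c m)) → (n : ℕ) → 0 < n →
    (k : ℕ) (t : List Bool) → length t < n →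
    Vtx c n ((k , t) ⌢ false) → Vtx c n ((k , t) ⌢ true) →
    ∃ λ d → Dist c n ((k , t) ⌢ false) ((k , t) ⌢ true) d × Odd d
-- v⌢0 alone makes v a vertex of the previous level.
lemma3p4 c c-odd (suc n) _ k t _ v⌢0 _ =
  _ , copies-distance S , r+[2+m+r]-odd (rest S) (c-odd n)
  where
  open L c
  S = splits (⌢-vertex⁻¹ v⌢0)
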